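{- In each of the labelled calculi $\mathbf{CL},\mathbf{CL^N},\mathbf{CL^T},\mathbf{CL^W},\mathbf{CL^C},\mathbf{CL^U},\mathbf{CL^{NU}},\mathbf{CL^{TU}},\mathbf{CL^{WU}},\mathbf{CL^{CU}},\mathbf{CL^A},\mathbf{CL^{NA}},\mathbf{CL^{TA}},\mathbf{CL^{WA}},\mathbf{CL^{CA}}$, every rule is height-preserving invertible: if the conclusion of an instance of a rule is derivable with height at most $n$, then each of its premisses is derivable with height at most $n$.
   Context: Height of a derivation: number of nodes in its longest branch minus one. Formulas: built from atoms and $\bot$ by $\wedge,\vee,\rightarrow,>$. Labels: world labels $x,y,z,\dots$; neighbourhood labels $a,b,c,\dots$, and for each world label $x$ a neighbourhood label $\{x\}$. Relational atoms: $a\in N(x)$, $x\in a$, $a\subseteq b$. Labelled formulas: relational atoms, $x:A$, $a\Vdash^\exists A$, $a\Vdash^\forall A$, $x\Vdash_a A|B$. Sequents $\Gamma\Rightarrow\Delta$: multisets of labelled formulas, relational atoms only in $\Gamma$. Rules are written premiss(es) / conclusion; "($u$ fresh)" means $u$ does not occur in the conclusion. $\mathbf{CL}$: initial sequents $x:p,\Gamma\Rightarrow\Delta,x:p$ ($p$ atom) and $x:\bot,\Gamma\Rightarrow\Delta$; L$\wedge$: $x:A,x:B,\Gamma\Rightarrow\Delta$ / $x:A\wedge B,\Gamma\Rightarrow\Delta$; R$\wedge$: $\Gamma\Rightarrow\Delta,x:A$ and $\Gamma\Rightarrow\Delta,x:B$ / $\Gamma\Rightarrow\Delta,x:A\wedge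 B$; L$\vee$: $x:A,\Gamma\Rightarrow\Delta$ and $x:B,\Gamma\Rightarrow\Delta$ / $x:A\vee B,\Gamma\Rightarrow\Delta$; R$\vee$: $\Gamma\Rightarrow\Delta,x:A,x:B$ / $\Gamma\Rightarrow\Delta,x:A\vee B$; L$\rightarrow$: $\Gamma\Rightarrow\Delta,x:A$ and $x:B,\Gamma\Rightarrow\Delta$ / $x:A\rightarrow B,\Gamma\Rightarrow\Delta$; R$\rightarrow$: $x:A,\Gamma\Rightarrow\Delta,x:B$ / $\Gamma\Rightarrow\Delta,x:A\rightarrow B$; L$\forall$: $x:A,x\in a,a\Vdash^\forall A,\Gamma\Rightarrow\Delta$ / $x\in a,a\Vdash^\forall A,\Gamma\Rightarrow\Delta$; R$\forall$ ($x$ fresh): $x\in a,\Gamma\Rightarrow\Delta,x:A$ / $\Gamma\Rightarrow\Delta,a\Vdash^\forall A$; L$\exists$ ($x$ fresh): $x\in a,x:A,\Gamma\Rightarrow\Delta$ / $a\Vdash^\exists A,\Gamma\Rightarrow\Delta$; R$\exists$: $x\in a,\Gamma\Rightarrow\Delta,x:A,a\Vdash^\exists A$ / $x\in a,\Gamma\Rightarrow\Delta,a\Vdash^\exists A$; R$>$ ($a$ fresh): $a\in N(x),a\Vdash^\exists A,\Gamma\Rightarrow\Delta,x\Vdash_a A|B$ / $\Gamma\Rightarrow\Delta,x:A>B$; L$>$: $a\in N(x),x:A>B,\Gamma\Rightarrow\Delta,a\Vdash^\exists A$ and $x\Vdash_a A|B,a\in N(x),x:A>B,\Gamma\Rightarrow\Delta$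 / $a\in N(x),x:A>B,\Gamma\Rightarrow\Delta$; R$|$: $c\in N(x),c\subseteq a,\Gamma\Rightarrow\Delta,x\Vdash_a A|B,c\Vdash^\exists A$ and $c\in N(x),c\subseteq a,\Gamma\Rightarrow\Delta,x\Vdash_a A|B,c\Vdash^\forall A\rightarrow B$ / $c\in N(x),c\subseteq a,\Gamma\Rightarrow\Delta,x\Vdash_a A|B$; L$|$ ($c$ fresh): $c\in N(x),c\subseteq a,c\Vdash^\exists A,c\Vdash^\forall A\rightarrow B,\Gamma\Rightarrow\Delta$ / $x\Vdash_a A|B,\Gamma\Rightarrow\Delta$; Ref: $a\subseteq a,\Gamma\Rightarrow\Delta$ / $\Gamma\Rightarrow\Delta$; Tr: $c\subseteq a,c\subseteq b,b\subseteq a,\Gamma\Rightarrow\Delta$ / $c\subseteq b,b\subseteq a,\Gamma\Rightarrow\Delta$; L$\subseteq$: $x\in a,a\subseteq b,x\in b,\Gamma\Rightarrow\Delta$ / $x\in a,a\subseteq b,\Gamma\Rightarrow\Delta$. Extension rules: N ($a$ fresh): $a\in N(x),\Gamma\Rightarrow\Delta$ / $\Gamma\Rightarrow\Delta$; 0 ($y$ fresh): $y\in a,a\in N(x),\Gamma\Rightarrow\Delta$ / $a\in N(x),\Gamma\Rightarrow\Delta$; T ($a$ fresh): $x\in a,a\in N(x),\Gamma\Rightarrow\Delta$ / $\Gamma\Rightarrow\Delta$; W: $x\in a,a\in N(x),\Gamma\Rightarrow\Delta$ / $a\in N(x),\Gamma\Rightarrow\Delta$; Single: $x\in\{x\},\{x\}\in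 N(x),\Gamma\Rightarrow\Delta$ / $\{x\}\in N(x),\Gamma\Rightarrow\Delta$; C: $\{x\}\in N(x),\{x\}\subseteq a,a\in N(x),\Gamma\Rightarrow\Delta$ / $a\in N(x),\Gamma\Rightarrow\Delta$; Repl$_1$: $y\in\{x\},At(x),At(y),\Gamma\Rightarrow\Delta$ / $y\in\{x\},At(x),\Gamma\Rightarrow\Delta$ and Repl$_2$: $y\in\{x\},At(x),At(y),\Gamma\Rightarrow\Delta$ / $y\in\{x\},At(y),\Gamma\Rightarrow\Delta$, where $At(x)$ is one of $x:P$ ($P$ atom), $x\in a$, $a\in N(x)$, $x\in\{z\}$ and $At(y)$ replaces $x$ by $y$; U$_1$ ($c$ fresh): $z\in c,c\in N(x),a\in N(x),y\in a,b\in N(y),z\in b,\Gamma\Rightarrow\Delta$ / $a\in N(x),y\in a,b\in N(y),z\in b,\Gamma\Rightarrow\Delta$; U$_2$ ($c$ fresh): $z\in c,c\in N(y),a\in N(x),y\in a,b\in N(x),z\in b,\Gamma\Rightarrow\Delta$ / $a\in N(x),y\in a,b\in N(x),z\in b,\Gamma\Rightarrow\Delta$; A$_1$: $b\in N(y),a\in N(x),y\in a,b\in N(x),\Gamma\Rightarrow\Delta$ / $a\in N(x),y\in a,b\in N(x),\Gamma\Rightarrow\Delta$; A$_2$: $b\in N(x),a\in N(x),y\in a,b\in N(y),\Gamma\Rightarrow\Delta$ / $a\in N(x),y\in a,b\in N(y),\Gamma\Rightarrow\Delta$; together with the instances of U$_1$, U$_2$, A$_1$, A$_2$ in which two coinciding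 principal atoms of the conclusion are written once (closure condition). Calculi: $\mathbf{CL^N}=\mathbf{CL}$+N+0; $\mathbf{CL^T}=\mathbf{CL^N}$+T; $\mathbf{CL^W}=\mathbf{CL^T}$+W; $\mathbf{CL^C}=\mathbf{CL^W}$+C+Single+Repl$_1$+Repl$_2$; $\mathbf{CL^U}=\mathbf{CL}$+U$_1$+U$_2$; $\mathbf{CL^{NU}},\mathbf{CL^{TU}},\mathbf{CL^{WU}},\mathbf{CL^{CU}}$ are $\mathbf{CL^N},\mathbf{CL^T},\mathbf{CL^W},\mathbf{CL^C}$ plus U$_1$,U$_2$; $\mathbf{CL^A}=\mathbf{CL}$+A$_1$+A$_2$; $\mathbf{CL^{NA}},\dots,\mathbf{CL^{CA}}$ are $\mathbf{CL^N},\dots,\mathbf{CL^C}$ plus A$_1$,A$_2$. -}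

module Defs where

open import Data.Nat using (ℕ; suc; _≤_)
open import Data.List using (List; []; _∷_; _++_; concatMap)
open import Data.List.Membership.Propositional using (_∈_; _∉_)
open import Data.List.Relation.Unary.All using (All)
open import Data.List.Relation.Binary.Permutation.Propositional using (_↭_)
open import Data.List.Relation.Binary.Pointwise using (Pointwise)
import Data.List.Relation.Binary.Sublist.Propositional as SL
open import Data.Product using (Σ; ∃; _×_; _,_)
open import Data.Sum using (_⊎_)
open import Relation.Binary.PropositionalEquality using (_≡_)

-- Formulas: atoms (indexed by ℕ), ⊥, ∧, ∨, →, > (conditional)

data Fm : Set where
  atm  : ℕ → Fm
  ⊥'   : Fm
  _∧'_ : Fm → Fm → Fm
  _∨'_ : Fm → Fm → Fm
  _⇒'_ : Fm → Fm → Fm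
  _>'_ : Fm → Fm → Fm

WL : Set
WL = ℕ

-- Neighbourhood labels: variables a, b, c, ... (nv n) and singletons {x}.
data NL : Set where
  nv  : ℕ → NL
  ⟦_⟧ : WL → NL

data Rel : Set where
  _∈N_ : NL → WL → Rel
  _∈ℓ_ : WL → NL → Rel
  _⊆ℓ_ : NL → NL → Rel

data LF : Set where
  _∶_       : WL → Fm → LF
  _⊩∃_      : NL → Fm → LF
  _⊩∀_      : NL → Fm → LF
  _⊩[_]_∣_  : WL → NL → Fm → Fm → LF

-- Antecedent formulas: relational atoms or labelled formulas.
-- (Relational atoms may only occur in the antecedent.)
data AF : Set where
  rel : Rel → AF
  lf  : LF → AF

-- Sequents Γ ⇒ Δ (lists, read as multisets via permutation below)
infix 4 _⇒_
record Seq : Set where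
  constructor _⇒_
  field
    ant : List AF
    succ : List LF
open Seq public

wNL : NL → List WL
wNL (nv _) = []
wNL ⟦ x ⟧ = x ∷ []

wRel : Rel → List WL
wRel (a ∈N x) = x ∷ wNL a
wRel (x ∈ℓ a) = x ∷ wNL a
wRel (a ⊆ℓ b) = wNL a ++ wNL b

wLF : LF → List WL
wLF (x ∶ A) = x ∷ []
wLF (a ⊩∃ A) = wNL a
wLF (a ⊩∀ A) = wNL a
wLF (x ⊩[ a ] A ∣ B) = x ∷ wNL a

wAF : AF → List WL
wAF (rel r) = wRel r
wAF (lf f) = wLF f

wSeq : Seq → List WL
wSeq (Γ ⇒ Δ) = concatMap wAF Γ ++ concatMap wLF Δ

nRel : Rel → List NL
nRel (a ∈N x) = a ∷ []
nRel (x ∈ℓ a) = a ∷ []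
nRel (a ⊆ℓ b) = a ∷ b ∷ []

nLF : LF → List NL
nLF (x ∶ A) = []
nLF (a ⊩∃ A) = a ∷ []
nLF (a ⊩∀ A) = a ∷ []
nLF (x ⊩[ a ] A ∣ B) = a ∷ []

nAF : AF → List NL
nAF (rel r) = nRel r
nAF (lf f) = nLF f

nSeq : Seq → List NL
nSeq (Γ ⇒ Δ) = concatMap nAF Γ ++ concatMap nLF Δ

-- world label y does not occur in S (not even inside a singleton label {y})
FreshW : WL → Seq → Set
FreshW y S = y ∉ wSeq S

FreshN : ℕ → Seq → Set
FreshN c S = nv c ∉ nSeq S

-- Calculi: a level (CL, N, T, W, C) and a choice of (none, U, A);
-- the 15 combinations are exactly the 15 calculi.

data Lvl : Set where
  lBase lN lT lW lC : Lvl

rank : Lvl → ℕ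
rank lBase = 0
rank lN = 1
rank lT = 2
rank lW = 3
rank lC = 4

data UA : Set where
  none uU aA : UA

record Calc : Set where
  constructor calc
  field
    lvl : Lvl
    ua  : UA
open Calc public

-- Atomic formulas At(x) for Repl: templates x:P, x ∈ a, a ∈ N(x), x ∈ {z}

data AtT : Set where
  tAtom : ℕ → AtT
  tIn   : NL → AtT
  tNb   : NL → AtT
  tInS  : WL → AtT

At : AtT → WL → AF
At (tAtom P) x = lf (x ∶ atm P)
At (tIn a) x = rel (x ∈ℓ a)
At (tNb a) x = rel (a ∈N x)
At (tInS z) x = rel (x ∈ℓ ⟦ z ⟧)

-- Closure condition: Q is P with some coinciding (duplicate) atoms
-- written once: Q is a sublist of P containing every element of P.
Contr : List AF → List AF → Set
Contr Q P = (Q SL.⊆ P) × (∀ {e} → e ∈ P → e ∈ Q)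

-- Rules of a calculus K: Rule K premisses conclusion
-- (principal formulas written at the front; instances are taken up to
-- multiset equality below)





data Rule (K : Calc) : List Seq → Seq → Set where
  L∧ : ∀ {x A B Γ Δ} →
    Rule K ((lf (x ∶ A) ∷ lf (x ∶ B) ∷ Γ ⇒ Δ) ∷ []) (lf (x ∶ (A ∧' B)) ∷ Γ ⇒ Δ)
  R∧ : ∀ {x A B Γ Δ} →
    Rule K ((Γ ⇒ (x ∶ A) ∷ Δ) ∷ (Γ ⇒ (x ∶ B) ∷ Δ) ∷ []) (Γ ⇒ (x ∶ (A ∧' B)) ∷ Δ)
  L∨ : ∀ {x A B Γ Δ} →
    Rule K ((lf (x ∶ A) ∷ Γ ⇒ Δ) ∷ (lf (x ∶ B) ∷ Γ ⇒ Δ) ∷ []) (lf (x ∶ (A ∨' B)) ∷ Γ ⇒ Δ)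
  R∨ : ∀ {x A B Γ Δ} →
    Rule K ((Γ ⇒ (x ∶ A) ∷ (x ∶ B) ∷ Δ) ∷ []) (Γ ⇒ (x ∶ (A ∨' B)) ∷ Δ)
  L⇒ : ∀ {x A B Γ Δ} →
    Rule K ((Γ ⇒ (x ∶ A) ∷ Δ) ∷ (lf (x ∶ B) ∷ Γ ⇒ Δ) ∷ []) (lf (x ∶ (A ⇒' B)) ∷ Γ ⇒ Δ)
  R⇒ : ∀ {x A B Γ Δ} →
    Rule K ((lf (x ∶ A) ∷ Γ ⇒ (x ∶ B) ∷ Δ) ∷ []) (Γ ⇒ (x ∶ (A ⇒' B)) ∷ Δ)
  L∀ : ∀ {x a A Γ Δ} →
    Rule K ((lf (x ∶ A) ∷ rel (x ∈ℓ a) ∷ lf (a ⊩∀ A) ∷ Γ ⇒ Δ) ∷ [])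
           (rel (x ∈ℓ a) ∷ lf (a ⊩∀ A) ∷ Γ ⇒ Δ)
  R∀ : ∀ {x a A Γ Δ} → FreshW x (Γ ⇒ (a ⊩∀ A) ∷ Δ) →
    Rule K ((rel (x ∈ℓ a) ∷ Γ ⇒ (x ∶ A) ∷ Δ) ∷ []) (Γ ⇒ (a ⊩∀ A) ∷ Δ)
  L∃ : ∀ {x a A Γ Δ} → FreshW x (lf (a ⊩∃ A) ∷ Γ ⇒ Δ) →
    Rule K ((rel (x ∈ℓ a) ∷ lf (x ∶ A) ∷ Γ ⇒ Δ) ∷ []) (lf (a ⊩∃ A) ∷ Γ ⇒ Δ)
  R∃ : ∀ {x a A Γ Δ} →
    Rule K ((rel (x ∈ℓ a) ∷ Γ ⇒ (x ∶ A) ∷ (a ⊩∃ A) ∷ Δ) ∷ [])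
           (rel (x ∈ℓ a) ∷ Γ ⇒ (a ⊩∃ A) ∷ Δ)
  R> : ∀ {x a A B Γ Δ} → FreshN a (Γ ⇒ (x ∶ (A >' B)) ∷ Δ) →
    Rule K ((rel (nv a ∈N x) ∷ lf (nv a ⊩∃ A) ∷ Γ ⇒ (x ⊩[ nv a ] A ∣ B) ∷ Δ) ∷ [])
           (Γ ⇒ (x ∶ (A >' B)) ∷ Δ)
  L> : ∀ {x a A B Γ Δ} →
    Rule K ((rel (a ∈N x) ∷ lf (x ∶ (A >' B)) ∷ Γ ⇒ (a ⊩∃ A) ∷ Δ)
           ∷ (lf (x ⊩[ a ] A ∣ B) ∷ rel (a ∈N x) ∷ lf (x ∶ (A >' B)) ∷ Γ ⇒ Δ) ∷ [])
           (rel (a ∈N x) ∷ lf (x ∶ (A >' B)) ∷ Γ ⇒ Δ)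
  R∣ : ∀ {x a c A B Γ Δ} →
    Rule K ((rel (c ∈N x) ∷ rel (c ⊆ℓ a) ∷ Γ ⇒ (x ⊩[ a ] A ∣ B) ∷ (c ⊩∃ A) ∷ Δ)
           ∷ (rel (c ∈N x) ∷ rel (c ⊆ℓ a) ∷ Γ ⇒ (x ⊩[ a ] A ∣ B) ∷ (c ⊩∀ (A ⇒' B)) ∷ Δ) ∷ [])
           (rel (c ∈N x) ∷ rel (c ⊆ℓ a) ∷ Γ ⇒ (x ⊩[ a ] A ∣ B) ∷ Δ)
  L∣ : ∀ {x a c A B Γ Δ} → FreshN c (lf (x ⊩[ a ] A ∣ B) ∷ Γ ⇒ Δ) →
    Rule K ((rel (nv c ∈N x) ∷ rel (nv c ⊆ℓ a) ∷ lf (nv c ⊩∃ A)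
              ∷ lf (nv c ⊩∀ (A ⇒' B)) ∷ Γ ⇒ Δ) ∷ [])
           (lf (x ⊩[ a ] A ∣ B) ∷ Γ ⇒ Δ)
  Ref : ∀ {a Γ Δ} →
    Rule K ((rel (a ⊆ℓ a) ∷ Γ ⇒ Δ) ∷ []) (Γ ⇒ Δ)
  Tr : ∀ {a b c Γ Δ} →
    Rule K ((rel (c ⊆ℓ a) ∷ rel (c ⊆ℓ b) ∷ rel (b ⊆ℓ a) ∷ Γ ⇒ Δ) ∷ [])
           (rel (c ⊆ℓ b) ∷ rel (b ⊆ℓ a) ∷ Γ ⇒ Δ)
  L⊆ : ∀ {x a b Γ Δ} →
    Rule K ((rel (x ∈ℓ a) ∷ rel (a ⊆ℓ b) ∷ rel (x ∈ℓ b) ∷ Γ ⇒ Δ) ∷ [])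
           (rel (x ∈ℓ a) ∷ rel (a ⊆ℓ b) ∷ Γ ⇒ Δ)
  RN : ∀ {x a Γ Δ} → 1 ≤ rank (lvl K) → FreshN a (Γ ⇒ Δ) →
    Rule K ((rel (nv a ∈N x) ∷ Γ ⇒ Δ) ∷ []) (Γ ⇒ Δ)
  R0 : ∀ {x y a Γ Δ} → 1 ≤ rank (lvl K) → FreshW y (rel (a ∈N x) ∷ Γ ⇒ Δ) →
    Rule K ((rel (y ∈ℓ a) ∷ rel (a ∈N x) ∷ Γ ⇒ Δ) ∷ []) (rel (a ∈N x) ∷ Γ ⇒ Δ)
  RT : ∀ {x a Γ Δ} → 2 ≤ rank (lvl K) → FreshN a (Γ ⇒ Δ) →
    Rule K ((rel (x ∈ℓ nv a) ∷ rel (nv a ∈N x) ∷ Γ ⇒ Δ) ∷ []) (Γ ⇒ Δ)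
  RW : ∀ {x a Γ Δ} → 3 ≤ rank (lvl K) →
    Rule K ((rel (x ∈ℓ a) ∷ rel (a ∈N x) ∷ Γ ⇒ Δ) ∷ []) (rel (a ∈N x) ∷ Γ ⇒ Δ)
  RSingle : ∀ {x Γ Δ} → lvl K ≡ lC →
    Rule K ((rel (x ∈ℓ ⟦ x ⟧) ∷ rel (⟦ x ⟧ ∈N x) ∷ Γ ⇒ Δ) ∷ []) (rel (⟦ x ⟧ ∈N x) ∷ Γ ⇒ Δ)
  RC : ∀ {x a Γ Δ} → lvl K ≡ lC →
    Rule K ((rel (⟦ x ⟧ ∈N x) ∷ rel (⟦ x ⟧ ⊆ℓ a) ∷ rel (a ∈N x) ∷ Γ ⇒ Δ) ∷ [])
           (rel (a ∈N x) ∷ Γ ⇒ Δ)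
  Repl₁ : ∀ {x y t Γ Δ} → lvl K ≡ lC →
    Rule K ((rel (y ∈ℓ ⟦ x ⟧) ∷ At t x ∷ At t y ∷ Γ ⇒ Δ) ∷ [])
           (rel (y ∈ℓ ⟦ x ⟧) ∷ At t x ∷ Γ ⇒ Δ)
  Repl₂ : ∀ {x y t Γ Δ} → lvl K ≡ lC →
    Rule K ((rel (y ∈ℓ ⟦ x ⟧) ∷ At t x ∷ At t y ∷ Γ ⇒ Δ) ∷ [])
           (rel (y ∈ℓ ⟦ x ⟧) ∷ At t y ∷ Γ ⇒ Δ)
  U₁ : ∀ {x y z a b c Q Γ Δ} → ua K ≡ uU →
    Contr Q (rel (a ∈N x) ∷ rel (y ∈ℓ a) ∷ rel (b ∈N y) ∷ rel (z ∈ℓ b) ∷ []) →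
    FreshN c (Q ++ Γ ⇒ Δ) →
    Rule K ((rel (z ∈ℓ nv c) ∷ rel (nv c ∈N x) ∷ Q ++ Γ ⇒ Δ) ∷ []) (Q ++ Γ ⇒ Δ)
  U₂ : ∀ {x y z a b c Q Γ Δ} → ua K ≡ uU →
    Contr Q (rel (a ∈N x) ∷ rel (y ∈ℓ a) ∷ rel (b ∈N x) ∷ rel (z ∈ℓ b) ∷ []) →
    FreshN c (Q ++ Γ ⇒ Δ) →
    Rule K ((rel (z ∈ℓ nv c) ∷ rel (nv c ∈N y) ∷ Q ++ Γ ⇒ Δ) ∷ []) (Q ++ Γ ⇒ Δ)
  A₁ : ∀ {x y a b Q Γ Δ} → ua K ≡ aA →
    Contr Q (rel (a ∈N x) ∷ rel (y ∈ℓ a) ∷ rel (b ∈N x) ∷ []) →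
    Rule K ((rel (b ∈N y) ∷ Q ++ Γ ⇒ Δ) ∷ []) (Q ++ Γ ⇒ Δ)
  A₂ : ∀ {x y a b Q Γ Δ} → ua K ≡ aA →
    Contr Q (rel (a ∈N x) ∷ rel (y ∈ℓ a) ∷ rel (b ∈N y) ∷ []) →
    Rule K ((rel (b ∈N x) ∷ Q ++ Γ ⇒ Δ) ∷ []) (Q ++ Γ ⇒ Δ)

_≈S_ : Seq → Seq → Set
S ≈S T = (ant S ↭ ant T) × (succ S ↭ succ T)

Inst : Calc → List Seq → Seq → Set
Inst K Ps S = Σ (List Seq) λ Ps′ → Σ Seq λ S′ →
  Rule K Ps′ S′ × S ≈S S′ × Pointwise _≈S_ Ps Ps′

Initial : Seq → Set
Initial S = (∃ λ x → ∃ λ p → lf (x ∶ atm p) ∈ ant S × (x ∶ atm p) ∈ succ S)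
          ⊎ (∃ λ x → lf (x ∶ ⊥') ∈ ant S)

data Der (K : Calc) : ℕ → Seq → Set where
  init : ∀ {n S} → Initial S → Der K n S
  step : ∀ {n Ps S} → Inst K Ps S → All (Der K n) Ps → Der K (suc n) S

-- Every rule either repeats its principal formulas in its premisses, or consumes one compound
-- formula (the propositional rules, R∀, L∃, R> and L∣).  A repeating rule is inverted by
-- height-preserving weakening.  A consuming rule is inverted by induction on the height: if the
-- consumed formula is principal in the last step, the premisses of that step are the wanted ones
-- up to a renaming of the eigenvariable; otherwise the formula lies in the context of the last
-- rule, and one inverts the premisses and applies the rule again.  Both arguments rest on
-- height-preserving substitution of labels, which holds because every rule instance remains an
-- instance after renaming its labels and replacing its context, once its eigenvariables are
-- renamed apart.
module Submission where

open import Defs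
open import Data.Nat using (ℕ; suc)
open import Data.Nat.Properties using (_≟_; n≮n)
open import Data.List using (List; []; _∷_; _++_; map; concatMap)
import Data.List.Properties as List
open import Data.List.Extrema.Nat using (max; xs≤max)
open import Data.List.Relation.Unary.All as All using (All; []; _∷_)
import Data.List.Relation.Unary.All.Properties as AllP
open import Data.List.Relation.Unary.Any as Any using (here; there)
open import Data.List.Membership.Propositional using (_∈_; _∉_)
open import Data.List.Membership.Propositional.Properties using (∈-concatMap⁺; ∈-map⁺; ∈-map⁻; ∈-++⁻; ∈-∃++)
open import Data.List.Relation.Binary.Subset.Propositional using (_⊆_)
import Data.List.Relation.Binary.Subset.Propositional.Properties as Subset
open import Data.List.Relation.Binary.Permutation.Propositional using (↭-refl; ↭-sym; ↭-trans; ↭-swap; ↭-reflexive)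
import Data.List.Relation.Binary.Permutation.Propositional.Properties as Perm
open import Data.List.Relation.Binary.Pointwise using (Pointwise; []; _∷_; All-resp-Pointwise; symmetric)
import Data.List.Relation.Binary.Sublist.Propositional.Properties as Sublist
open import Data.Product using (Σ; ∃; _×_; _,_; proj₁)
open import Data.Sum using (_⊎_; inj₁; inj₂)
open import Data.Unit using (⊤; tt)
open import Data.Empty using (⊥; ⊥-elim)
open import Function using (_∘′_)
open import Relation.Nullary using (¬_; yes; no)
open import Relation.Binary using (Setoid)
import Relation.Binary.Reasoning.Setoid as SetoidReasoning
open import Relation.Binary.PropositionalEquality
  using (_≡_; _≢_; refl; sym; trans; cong; cong₂; subst; subst₂; module ≡-Reasoning)

-- Sequents up to multiset equality

infixr 25 _⊗_
_⊗_ : Seq → Seq → Seq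
S ⊗ T = ant S ++ ant T ⇒ succ S ++ succ T

≈S-refl : ∀ {S} → S ≈S S
≈S-refl = ↭-refl , ↭-refl

≈S-sym : ∀ {S T} → S ≈S T → T ≈S S
≈S-sym (p , q) = ↭-sym p , ↭-sym q

≈S-trans : ∀ {S T U} → S ≈S T → T ≈S U → S ≈S U
≈S-trans (p , q) (p′ , q′) = ↭-trans p p′ , ↭-trans q q′

≈S-setoid : Setoid _ _
≈S-setoid = record
  { Carrier = Seq
  ; _≈_ = _≈S_
  ; isEquivalence = record { refl = ≈S-refl ; sym = ≈S-sym ; trans = ≈S-trans }
  }

⊗-congˡ : ∀ {S S′} T → S ≈S S′ → S ⊗ T ≈S S′ ⊗ T
⊗-congˡ T (p , q) = Perm.++⁺ʳ (ant T) p , Perm.++⁺ʳ (succ T) q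

⊗-congʳ : ∀ S {T T′} → T ≈S T′ → S ⊗ T ≈S S ⊗ T′
⊗-congʳ S (p , q) = Perm.++⁺ˡ (ant S) p , Perm.++⁺ˡ (succ S) q

⊗-assoc : ∀ S T U → (S ⊗ T) ⊗ U ≡ S ⊗ (T ⊗ U)
⊗-assoc S T U = cong₂ _⇒_ (List.++-assoc (ant S) (ant T) (ant U)) (List.++-assoc (succ S) (succ T) (succ U))

⊗-swap : ∀ S T U → S ⊗ (T ⊗ U) ≈S T ⊗ (S ⊗ U)
⊗-swap S T U = Perm.shifts (ant S) (ant T) , Perm.shifts (succ S) (succ T)

data Side : Set where
  left right : Side

only : Side → LF → Seq
only left F = lf F ∷ [] ⇒ []
only right F = [] ⇒ F ∷ []

only-injective : ∀ s {F G} → only s F ≡ only s G → F ≡ G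
only-injective left refl = refl
only-injective right refl = refl

only-cancel : ∀ s {F S T} → only s F ⊗ S ≈S only s F ⊗ T → S ≈S T
only-cancel left (p , q) = Perm.drop-∷ p , q
only-cancel right (p , q) = p , Perm.drop-∷ q

Occurs : Side → LF → Seq → Set
Occurs left F S = lf F ∈ ant S
Occurs right F S = F ∈ succ S

occurs-only : ∀ s {F C} → Occurs s F (only s F ⊗ C)
occurs-only left = here refl
occurs-only right = here refl

occurs-only⁻ : ∀ {s F s′ F′} → Occurs s F (only s′ F′) → (s , F) ≡ (s′ , F′)
occurs-only⁻ {left} {s′ = left} (here refl) = refl
occurs-only⁻ {right} {s′ = right} (here refl) = refl

occurs-resp : ∀ {s F S T} → S ≈S T → Occurs s F S → Occurs s F T
occurs-resp {left} (p , _) = Perm.∈-resp-↭ p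
occurs-resp {right} (_ , q) = Perm.∈-resp-↭ q

occurs-⊗ : ∀ {s F} S {T} → Occurs s F (S ⊗ T) → Occurs s F S ⊎ Occurs s F T
occurs-⊗ {left} S = ∈-++⁻ (ant S)
occurs-⊗ {right} S = ∈-++⁻ (succ S)

occurs-split : ∀ {s F C} → Occurs s F C → ∃ λ C₀ → C ≈S only s F ⊗ C₀
occurs-split {left} {F} {C} m with ∈-∃++ m
... | Γ₁ , Γ₂ , eq = (Γ₁ ++ Γ₂ ⇒ succ C) , ↭-trans (↭-reflexive eq) (Perm.shift (lf F) Γ₁ Γ₂) , ↭-refl
occurs-split {right} {F} {C} m with ∈-∃++ m
... | Δ₁ , Δ₂ , eq = (ant C ⇒ Δ₁ ++ Δ₂) , ↭-refl , ↭-trans (↭-reflexive eq) (Perm.shift F Δ₁ Δ₂)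

_⊑_ : Seq → Seq → Set
S ⊑ T = ant S ⊆ ant T × succ S ⊆ succ T

≈S⇒⊑ : ∀ {S T} → S ≈S T → S ⊑ T
≈S⇒⊑ (p , q) = Subset.⊆-reflexive-↭ p , Subset.⊆-reflexive-↭ q

⊑-⊗ˡ : ∀ S T → S ⊑ S ⊗ T
⊑-⊗ˡ S T = Subset.xs⊆xs++ys (ant S) (ant T) , Subset.xs⊆xs++ys (succ S) (succ T)

⊑-⊗ʳ : ∀ S T → T ⊑ S ⊗ T
⊑-⊗ʳ S T = Subset.xs⊆ys++xs (ant T) (ant S) , Subset.xs⊆ys++xs (succ T) (succ S)

wSeq-⊑ : ∀ {S T} → S ⊑ T → wSeq S ⊆ wSeq T
wSeq-⊑ (p , q) = Subset.++⁺ (Subset.concatMap⁺ wAF p) (Subset.concatMap⁺ wLF q)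

nSeq-⊑ : ∀ {S T} → S ⊑ T → nSeq S ⊆ nSeq T
nSeq-⊑ (p , q) = Subset.++⁺ (Subset.concatMap⁺ nAF p) (Subset.concatMap⁺ nLF q)

Initial-⊑ : ∀ {S T} → S ⊑ T → Initial S → Initial T
Initial-⊑ (p , q) (inj₁ (x , P , a , s)) = inj₁ (x , P , p a , q s)
Initial-⊑ (p , _) (inj₂ (x , a)) = inj₂ (x , p a)

Der-resp-≈S : ∀ {K n S T} → S ≈S T → Der K n S → Der K n T
Der-resp-≈S S≈T (init i) = init (Initial-⊑ (≈S⇒⊑ S≈T) i)
Der-resp-≈S S≈T (step (Ps , S′ , r , S≈S′ , pw) ds) =
  step (Ps , S′ , r , ≈S-trans (≈S-sym S≈T) S≈S′ , pw) ds

ruleDer : ∀ {K m Ps S} → Rule K Ps S → All (Der K m) Ps → Der K (suc m) S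
ruleDer {Ps = Ps} r ds = step (Ps , _ , r , ≈S-refl , pointwise-refl Ps) ds
  where
  pointwise-refl : ∀ Qs → Pointwise _≈S_ Qs Qs
  pointwise-refl [] = []
  pointwise-refl (Q ∷ Qs) = ≈S-refl ∷ pointwise-refl Qs

mutual
  Der-mono : ∀ {K n S} → Der K n S → Der K (suc n) S
  Der-mono (init i) = init i
  Der-mono (step inst ds) = step inst (All-Der-mono ds)

  All-Der-mono : ∀ {K n Ps} → All (Der K n) Ps → All (Der K (suc n)) Ps
  All-Der-mono [] = []
  All-Der-mono (d ∷ ds) = Der-mono d ∷ All-Der-mono ds

All-mapped : ∀ {A B C : Set} {P : B → Set} {Q : C → Set} {f : A → B} {g : A → C} xs →
  All P (map f xs) → (∀ {x} → P (f x) → Q (g x)) → All Q (map g xs)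
All-mapped xs ps h = AllP.map⁺ (All.map h (AllP.map⁻ ps))

-- Renamings of labels

record Renaming : Set where
  field
    onW : ℕ → ℕ
    onN : ℕ → ℕ
open Renaming

idR : Renaming
idR = record { onW = λ x → x ; onN = λ c → c }

renNL : Renaming → NL → NL
renNL σ (nv c) = nv (onN σ c)
renNL σ ⟦ x ⟧ = ⟦ onW σ x ⟧

renRel : Renaming → Rel → Rel
renRel σ (a ∈N x) = renNL σ a ∈N onW σ x
renRel σ (x ∈ℓ a) = onW σ x ∈ℓ renNL σ a
renRel σ (a ⊆ℓ b) = renNL σ a ⊆ℓ renNL σ b

renLF : Renaming → LF → LF
renLF σ (x ∶ A) = onW σ x ∶ A
renLF σ (a ⊩∃ A) = renNL σ a ⊩∃ A
renLF σ (a ⊩∀ A) = renNL σ a ⊩∀ A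
renLF σ (x ⊩[ a ] A ∣ B) = onW σ x ⊩[ renNL σ a ] A ∣ B

renAF : Renaming → AF → AF
renAF σ (rel r) = rel (renRel σ r)
renAF σ (lf F) = lf (renLF σ F)

rename : Renaming → Seq → Seq
rename σ S = map (renAF σ) (ant S) ⇒ map (renLF σ) (succ S)

rename-⊗ : ∀ σ S T → rename σ (S ⊗ T) ≡ rename σ S ⊗ rename σ T
rename-⊗ σ S T = cong₂ _⇒_ (List.map-++ (renAF σ) (ant S) (ant T)) (List.map-++ (renLF σ) (succ S) (succ T))

rename-only : ∀ σ s F → rename σ (only s F) ≡ only s (renLF σ F)
rename-only σ left F = refl
rename-only σ right F = refl

rename-resp : ∀ σ {S T} → S ≈S T → rename σ S ≈S rename σ T
rename-resp σ (p , q) = Perm.map⁺ (renAF σ) p , Perm.map⁺ (renLF σ) q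

Initial-rename : ∀ σ {S} → Initial S → Initial (rename σ S)
Initial-rename σ (inj₁ (x , P , a , s)) = inj₁ (onW σ x , P , ∈-map⁺ (renAF σ) a , ∈-map⁺ (renLF σ) s)
Initial-rename σ (inj₂ (x , a)) = inj₂ (onW σ x , ∈-map⁺ (renAF σ) a)

renNL-id : ∀ a → renNL idR a ≡ a
renNL-id (nv c) = refl
renNL-id ⟦ x ⟧ = refl

renLF-id : ∀ F → renLF idR F ≡ F
renLF-id (x ∶ A) = refl
renLF-id (a ⊩∃ A) = cong (_⊩∃ A) (renNL-id a)
renLF-id (a ⊩∀ A) = cong (_⊩∀ A) (renNL-id a)
renLF-id (x ⊩[ a ] A ∣ B) = cong (λ b → x ⊩[ b ] A ∣ B) (renNL-id a)

renAF-id : ∀ φ → renAF idR φ ≡ φ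
renAF-id (rel (a ∈N x)) = cong (λ b → rel (b ∈N x)) (renNL-id a)
renAF-id (rel (x ∈ℓ a)) = cong (λ b → rel (x ∈ℓ b)) (renNL-id a)
renAF-id (rel (a ⊆ℓ b)) = cong₂ (λ a′ b′ → rel (a′ ⊆ℓ b′)) (renNL-id a) (renNL-id b)
renAF-id (lf F) = cong lf (renLF-id F)

rename-id : ∀ S → rename idR S ≡ S
rename-id S = cong₂ _⇒_ (trans (List.map-cong renAF-id (ant S)) (List.map-id (ant S)))
                        (trans (List.map-cong renLF-id (succ S)) (List.map-id (succ S)))

update : (ℕ → ℕ) → ℕ → ℕ → ℕ → ℕ
update f e v u with u ≟ e
... | yes _ = v
... | no _ = f u

update-at : ∀ f e v → update f e v e ≡ v
update-at f e v with e ≟ e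
... | yes _ = refl
... | no e≢e = ⊥-elim (e≢e refl)

update-ne : ∀ f {e} v {u} → u ≢ e → update f e v u ≡ f u
update-ne f {e} v {u} u≢e with u ≟ e
... | yes u≡e = ⊥-elim (u≢e u≡e)
... | no _ = refl

updateW : Renaming → ℕ → ℕ → Renaming
updateW σ x w = record σ { onW = update (onW σ) x w }

updateN : Renaming → ℕ → ℕ → Renaming
updateN σ c d = record σ { onN = update (onN σ) c d }

-- A singleton {x} is renamed through x, which is already among the world labels.
NvAgree : Renaming → Renaming → NL → Set
NvAgree σ τ (nv c) = onN σ c ≡ onN τ c
NvAgree σ τ ⟦ _ ⟧ = ⊤

AgreeW : Renaming → Renaming → List WL → Set
AgreeW σ τ = All (λ x → onW σ x ≡ onW τ x)

AgreeN : Renaming → Renaming → List NL → Set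
AgreeN σ τ = All (NvAgree σ τ)

record Agree (σ τ : Renaming) (S : Seq) : Set where
  constructor agree
  field
    on-worlds : AgreeW σ τ (wSeq S)
    on-nbhds : AgreeN σ τ (nSeq S)

module _ {σ τ : Renaming} where

  agree-NL : ∀ a → AgreeW σ τ (wNL a) → NvAgree σ τ a → renNL σ a ≡ renNL τ a
  agree-NL (nv c) _ h = cong nv h
  agree-NL ⟦ x ⟧ (h ∷ []) _ = cong ⟦_⟧ h

  agree-LF : ∀ F → AgreeW σ τ (wLF F) → AgreeN σ τ (nLF F) → renLF σ F ≡ renLF τ F
  agree-LF (x ∶ A) (hx ∷ []) [] = cong (_∶ A) hx
  agree-LF (a ⊩∃ A) ha (na ∷ []) = cong (_⊩∃ A) (agree-NL a ha na)
  agree-LF (a ⊩∀ A) ha (na ∷ []) = cong (_⊩∀ A) (agree-NL a ha na)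
  agree-LF (x ⊩[ a ] A ∣ B) (hx ∷ ha) (na ∷ []) = cong₂ (λ y b → y ⊩[ b ] A ∣ B) hx (agree-NL a ha na)

  agree-AF : ∀ φ → AgreeW σ τ (wAF φ) → AgreeN σ τ (nAF φ) → renAF σ φ ≡ renAF τ φ
  agree-AF (rel (a ∈N x)) (hx ∷ ha) (na ∷ []) = cong₂ (λ b y → rel (b ∈N y)) (agree-NL a ha na) hx
  agree-AF (rel (x ∈ℓ a)) (hx ∷ ha) (na ∷ []) = cong₂ (λ y b → rel (y ∈ℓ b)) hx (agree-NL a ha na)
  agree-AF (rel (a ⊆ℓ b)) h (na ∷ nb ∷ []) =
    cong₂ (λ a′ b′ → rel (a′ ⊆ℓ b′))
      (agree-NL a (AllP.++⁻ˡ (wNL a) h) na) (agree-NL b (AllP.++⁻ʳ (wNL a) h) nb)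
  agree-AF (lf F) hw hn = cong lf (agree-LF F hw hn)

  agree-rename : ∀ S → Agree σ τ S → rename σ S ≡ rename τ S
  agree-rename S (agree hw hn) = cong₂ _⇒_
    (List.map-cong-local (All.zipWith (λ {φ} (p , q) → agree-AF φ p q)
      (split wAF (AllP.++⁻ˡ _ hw) , split nAF (AllP.++⁻ˡ _ hn))))
    (List.map-cong-local (All.zipWith (λ {F} (p , q) → agree-LF F p q)
      (split wLF (AllP.++⁻ʳ _ hw) , split nLF (AllP.++⁻ʳ _ hn))))
    where
    split : ∀ {A B : Set} {P : B → Set} (f : A → List B) {xs} → All P (concatMap f xs) → All (All P ∘′ f) xs
    split f = AllP.map⁻ ∘′ AllP.concat⁻

  agree-⊑ : ∀ {S T} → T ⊑ S → Agree σ τ S → Agree σ τ T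
  agree-⊑ T⊑S (agree hw hn) = agree (Subset.All-resp-⊇ (wSeq-⊑ T⊑S) hw) (Subset.All-resp-⊇ (nSeq-⊑ T⊑S) hn)

agree-refl : ∀ {σ} S → Agree σ σ S
agree-refl {σ} S = agree (All.tabulate (λ _ → refl)) (All.tabulate (λ {a} _ → nv-refl a))
  where
  nv-refl : ∀ a → NvAgree σ σ a
  nv-refl (nv c) = refl
  nv-refl ⟦ x ⟧ = tt

agree-trans : ∀ {σ τ ρ} S → Agree σ τ S → Agree τ ρ S → Agree σ ρ S
agree-trans {σ} {τ} {ρ} S (agree hw hn) (agree hw′ hn′) =
  agree (All.zipWith (λ (p , q) → trans p q) (hw , hw′)) (All.zipWith (λ {a} (p , q) → nv-trans a p q) (hn , hn′))
  where
  nv-trans : ∀ a → NvAgree σ τ a → NvAgree τ ρ a → NvAgree σ ρ a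
  nv-trans (nv c) = trans
  nv-trans ⟦ x ⟧ _ _ = tt

updateW-agree : ∀ {σ x w} S → x ∉ wSeq S → Agree (updateW σ x w) σ S
updateW-agree {σ} {x} {w} S x∉S =
  agree (All.tabulate (λ m → update-ne (onW σ) w (λ { refl → x∉S m }))) (All.tabulate (λ {a} _ → nv-same a))
  where
  nv-same : ∀ a → NvAgree (updateW σ x w) σ a
  nv-same (nv c) = refl
  nv-same ⟦ y ⟧ = tt

updateN-agree : ∀ {σ c d} S → nv c ∉ nSeq S → Agree (updateN σ c d) σ S
updateN-agree {σ} {c} {d} S c∉S = agree (All.tabulate (λ _ → refl)) (All.tabulate (λ {a} → nv-same a))
  where
  nv-same : ∀ a → a ∈ nSeq S → NvAgree (updateN σ c d) σ a
  nv-same (nv c′) m = update-ne (onN σ) d (λ { refl → c∉S m })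
  nv-same ⟦ y ⟧ _ = tt

fresh : List ℕ → ℕ
fresh xs = suc (max 0 xs)

fresh-∉ : ∀ xs → fresh xs ∉ xs
fresh-∉ xs m = n≮n _ (All.lookup (xs≤max 0 xs) m)

freshW : Seq → WL
freshW S = fresh (wSeq S)

freshW-∉ : ∀ S → freshW S ∉ wSeq S
freshW-∉ S = fresh-∉ (wSeq S)

nvIndex : NL → List ℕ
nvIndex (nv c) = c ∷ []
nvIndex ⟦ _ ⟧ = []

freshN : Seq → ℕ
freshN S = fresh (concatMap nvIndex (nSeq S))

freshN-∉ : ∀ S → nv (freshN S) ∉ nSeq S
freshN-∉ S m = fresh-∉ _ (∈-concatMap⁺ nvIndex (Any.map (λ { refl → here refl }) m))

-- Decomposition of rule instances

-- F on side s is principal in a rule whose premisses no longer contain it.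
data Consumed : Side → LF → Set where
  ∧L : ∀ {x A B} → Consumed left (x ∶ (A ∧' B))
  ∨L : ∀ {x A B} → Consumed left (x ∶ (A ∨' B))
  ⇒L : ∀ {x A B} → Consumed left (x ∶ (A ⇒' B))
  ∃L : ∀ {a A} → Consumed left (a ⊩∃ A)
  ∣L : ∀ {x a A B} → Consumed left (x ⊩[ a ] A ∣ B)
  ∧R : ∀ {x A B} → Consumed right (x ∶ (A ∧' B))
  ∨R : ∀ {x A B} → Consumed right (x ∶ (A ∨' B))
  ⇒R : ∀ {x A B} → Consumed right (x ∶ (A ⇒' B))
  ∀R : ∀ {a A} → Consumed right (a ⊩∀ A)
  >R : ∀ {x A B} → Consumed right (x ∶ (A >' B))

-- The premisses of the rule, without their context, with world eigenvariable w and
-- neighbourhood eigenvariable c (ignored by rules without eigenvariables).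
canon : ∀ {s F} → Consumed s F → WL → ℕ → List Seq
canon (∧L {x} {A} {B}) w c = (lf (x ∶ A) ∷ lf (x ∶ B) ∷ [] ⇒ []) ∷ []
canon (∨L {x} {A} {B}) w c = (lf (x ∶ A) ∷ [] ⇒ []) ∷ (lf (x ∶ B) ∷ [] ⇒ []) ∷ []
canon (⇒L {x} {A} {B}) w c = ([] ⇒ (x ∶ A) ∷ []) ∷ (lf (x ∶ B) ∷ [] ⇒ []) ∷ []
canon (∃L {a} {A}) w c = (rel (w ∈ℓ a) ∷ lf (w ∶ A) ∷ [] ⇒ []) ∷ []
canon (∣L {x} {a} {A} {B}) w c =
  (rel (nv c ∈N x) ∷ rel (nv c ⊆ℓ a) ∷ lf (nv c ⊩∃ A) ∷ lf (nv c ⊩∀ (A ⇒' B)) ∷ [] ⇒ []) ∷ []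
canon (∧R {x} {A} {B}) w c = ([] ⇒ (x ∶ A) ∷ []) ∷ ([] ⇒ (x ∶ B) ∷ []) ∷ []
canon (∨R {x} {A} {B}) w c = ([] ⇒ (x ∶ A) ∷ (x ∶ B) ∷ []) ∷ []
canon (⇒R {x} {A} {B}) w c = (lf (x ∶ A) ∷ [] ⇒ (x ∶ B) ∷ []) ∷ []
canon (∀R {a} {A}) w c = (rel (w ∈ℓ a) ∷ [] ⇒ (w ∶ A) ∷ []) ∷ []
canon (>R {x} {A} {B}) w c = (rel (nv c ∈N x) ∷ lf (nv c ⊩∃ A) ∷ [] ⇒ (x ⊩[ nv c ] A ∣ B) ∷ []) ∷ []

consumed-unique : ∀ {s F} (i j : Consumed s F) → i ≡ j
consumed-unique ∧L ∧L = refl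
consumed-unique ∨L ∨L = refl
consumed-unique ⇒L ⇒L = refl
consumed-unique ∃L ∃L = refl
consumed-unique ∣L ∣L = refl
consumed-unique ∧R ∧R = refl
consumed-unique ∨R ∨R = refl
consumed-unique ⇒R ⇒R = refl
consumed-unique ∀R ∀R = refl
consumed-unique >R >R = refl

Consumed-rename : ∀ σ {s F} → Consumed s F → Consumed s (renLF σ F)
Consumed-rename σ ∧L = ∧L
Consumed-rename σ ∨L = ∨L
Consumed-rename σ ⇒L = ⇒L
Consumed-rename σ ∃L = ∃L
Consumed-rename σ ∣L = ∣L
Consumed-rename σ ∧R = ∧R
Consumed-rename σ ∨R = ∨R
Consumed-rename σ ⇒R = ⇒R
Consumed-rename σ ∀R = ∀R
Consumed-rename σ >R = >R

canon-rename : ∀ σ {s F} (iv : Consumed s F) w c →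
  map (rename σ) (canon iv w c) ≡ canon (Consumed-rename σ iv) (onW σ w) (onN σ c)
canon-rename σ ∧L w c = refl
canon-rename σ ∨L w c = refl
canon-rename σ ⇒L w c = refl
canon-rename σ ∃L w c = refl
canon-rename σ ∣L w c = refl
canon-rename σ ∧R w c = refl
canon-rename σ ∨R w c = refl
canon-rename σ ⇒R w c = refl
canon-rename σ ∀R w c = refl
canon-rename σ >R w c = refl

canon-cong : ∀ {s F G} → F ≡ G → (i : Consumed s F) (j : Consumed s G) → ∀ w c → canon i w c ≡ canon j w c
canon-cong refl i j w c = cong (λ k → canon k w c) (consumed-unique i j)

Inert : Side → LF → Set
Inert left (_ ∶ atm _) = ⊤
Inert left (_ ∶ ⊥') = ⊤
Inert left (_ ∶ (_ >' _)) = ⊤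
Inert left (_ ⊩∀ _) = ⊤
Inert left _ = ⊥
Inert right (_ ∶ atm _) = ⊤
Inert right (_ ∶ ⊥') = ⊤
Inert right (_ ⊩∃ _) = ⊤
Inert right (_ ⊩[ _ ] _ ∣ _) = ⊤
Inert right _ = ⊥

consumed-not-inert : ∀ {s F} → Consumed s F → ¬ Inert s F
consumed-not-inert ∧L ()
consumed-not-inert ∨L ()
consumed-not-inert ⇒L ()
consumed-not-inert ∃L ()
consumed-not-inert ∣L ()
consumed-not-inert ∧R ()
consumed-not-inert ∨R ()
consumed-not-inert ⇒R ()
consumed-not-inert ∀R ()
consumed-not-inert >R ()

InertAF : AF → Set
InertAF (rel _) = ⊤
InertAF (lf F) = Inert left F

InertPart : Seq → Set
InertPart Π = All InertAF (ant Π) × All (Inert right) (succ Π)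

inert-occurs : ∀ {s F Π} → InertPart Π → Occurs s F Π → Inert s F
inert-occurs {left} (l , _) m = All.lookup l m
inert-occurs {right} (_ , r) m = All.lookup r m

At-inert : ∀ t x → InertAF (At t x)
At-inert (tAtom P) x = tt
At-inert (tIn a) x = tt
At-inert (tNb a) x = tt
At-inert (tInS z) x = tt

Initial-drop : ∀ {s F C} → Consumed s F → Initial (only s F ⊗ C) → Initial C
Initial-drop {left} () (inj₁ (_ , _ , here refl , _))
Initial-drop {left} _ (inj₁ (x , P , there a , s)) = inj₁ (x , P , a , s)
Initial-drop {left} () (inj₂ (_ , here refl))
Initial-drop {left} _ (inj₂ (x , there a)) = inj₂ (x , a)
Initial-drop {right} () (inj₁ (_ , _ , _ , here refl))
Initial-drop {right} _ (inj₁ (x , P , a , there s)) = inj₁ (x , P , a , s)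
Initial-drop {right} _ (inj₂ (x , a)) = inj₂ (x , a)

data RuleKind (S : Seq) : Seq → List Seq → Set where
  consuming : ∀ {s F} (iv : Consumed s F) w c → w ∉ wSeq S → nv c ∉ nSeq S →
    RuleKind S (only s F) (canon iv w c)
  repeating : ∀ {Π exs} → InertPart Π → All (λ E → ∃ λ E′ → E ≈S E′ ⊗ Π) exs → RuleKind S Π exs

consuming₀ : ∀ {S s F} (iv : Consumed s F) → RuleKind S (only s F) (canon iv (freshW S) (freshN S))
consuming₀ {S} iv = consuming iv _ _ (freshW-∉ S) (freshN-∉ S)

consumingW : ∀ {S s F} (iv : Consumed s F) x → x ∉ wSeq S → RuleKind S (only s F) (canon iv x (freshN S))
consumingW {S} iv x x∉ = consuming iv x _ x∉ (freshN-∉ S)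

consumingN : ∀ {S s F} (iv : Consumed s F) c → nv c ∉ nSeq S → RuleKind S (only s F) (canon iv (freshW S) c)
consumingN {S} iv c c∉ = consuming iv _ c (freshW-∉ S) c∉

adding : ∀ {Π} E′ → ∃ λ E″ → E′ ⊗ Π ≈S E″ ⊗ Π
adding E′ = E′ , ≈S-refl

Renamed : Calc → Seq → List Seq → Renaming → Renaming → Seq → Set
Renamed K Π exs σ′ σ C₂ = Rule K (map (λ E → rename σ′ E ⊗ C₂) exs) (rename σ Π ⊗ C₂)

-- σ′ renames the eigenvariables of the rule away from the new context C₂, agreeing with σ
-- on the old context C.
Schematic : Calc → Seq → Seq → List Seq → Set
Schematic K Π C exs = ∀ σ C₂ → Σ Renaming λ σ′ → Agree σ′ σ C × Renamed K Π exs σ′ σ C₂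

data Decomp (K : Calc) : List Seq → Seq → Set where
  decomp : ∀ Π C exs → RuleKind (Π ⊗ C) Π exs → Schematic K Π C exs → Decomp K (map (_⊗ C) exs) (Π ⊗ C)

module _ {K : Calc} {Π C : Seq} {exs : List Seq} where

  principal-fixed : ∀ {σ σ′} → Agree σ′ σ (Π ⊗ C) → rename σ′ Π ≡ rename σ Π
  principal-fixed agr = agree-rename Π (agree-⊑ (⊑-⊗ˡ Π C) agr)

  relabel : ∀ {σ σ′ C₂} → Agree σ′ σ (Π ⊗ C) → Renamed K Π exs σ′ σ′ C₂ →
    Σ Renaming λ σ″ → Agree σ″ σ C × Renamed K Π exs σ″ σ C₂
  relabel {σ′ = σ′} {C₂} agr r =
    σ′ , agree-⊑ (⊑-⊗ʳ Π C) agr , subst (λ P → Rule K _ (P ⊗ C₂)) (principal-fixed agr) r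

  uniformly : (∀ σ C₂ → Renamed K Π exs σ σ C₂) → Schematic K Π C exs
  uniformly r σ C₂ = relabel (agree-refl (Π ⊗ C)) (r σ C₂)

  eigenW : ∀ {x} → x ∉ wSeq (Π ⊗ C) →
    (∀ σ C₂ → onW σ x ∉ wSeq (rename σ Π ⊗ C₂) → Renamed K Π exs σ σ C₂) →
    Schematic K Π C exs
  eigenW {x} x∉ r σ C₂ = relabel agr (r σ′ C₂ x′∉)
    where
    w = freshW (rename σ Π ⊗ C₂)
    σ′ = updateW σ x w
    agr : Agree σ′ σ (Π ⊗ C)
    agr = updateW-agree (Π ⊗ C) x∉
    x′∉ : onW σ′ x ∉ wSeq (rename σ′ Π ⊗ C₂)
    x′∉ = subst₂ (λ u P → u ∉ wSeq (P ⊗ C₂)) (sym (update-at (onW σ) x w)) (sym (principal-fixed agr))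
            (freshW-∉ (rename σ Π ⊗ C₂))

  eigenN : ∀ {c} → nv c ∉ nSeq (Π ⊗ C) →
    (∀ σ C₂ → nv (onN σ c) ∉ nSeq (rename σ Π ⊗ C₂) → Renamed K Π exs σ σ C₂) →
    Schematic K Π C exs
  eigenN {c} c∉ r σ C₂ = relabel agr (r σ′ C₂ c′∉)
    where
    d = freshN (rename σ Π ⊗ C₂)
    σ′ = updateN σ c d
    agr : Agree σ′ σ (Π ⊗ C)
    agr = updateN-agree (Π ⊗ C) c∉
    c′∉ : nv (onN σ′ c) ∉ nSeq (rename σ′ Π ⊗ C₂)
    c′∉ = subst₂ (λ u P → nv u ∉ nSeq (P ⊗ C₂)) (sym (update-at (onN σ) c d)) (sym (principal-fixed agr))
            (freshN-∉ (rename σ Π ⊗ C₂))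

Contr-rename : ∀ σ {Q P} → Contr Q P → Contr (map (renAF σ) Q) (map (renAF σ) P)
Contr-rename σ {Q} {P} (Q⊆P , P⊆Q) = Sublist.map⁺ (renAF σ) Q⊆P , covers
  where
  covers : ∀ {φ} → φ ∈ map (renAF σ) P → φ ∈ map (renAF σ) Q
  covers m with ∈-map⁻ (renAF σ) m
  ... | _ , m₀ , refl = ∈-map⁺ (renAF σ) (P⊆Q m₀)

module _ {K : Calc} where

  -- renAF σ (At t x) computes to an At-formula only once the template t is known.
  Repl₁-renamed : ∀ σ t {x y Γ Δ} → lvl K ≡ lC →
    Rule K ((rel (onW σ y ∈ℓ ⟦ onW σ x ⟧) ∷ renAF σ (At t x) ∷ renAF σ (At t y) ∷ Γ ⇒ Δ) ∷ [])
           (rel (onW σ y ∈ℓ ⟦ onW σ x ⟧) ∷ renAF σ (At t x) ∷ Γ ⇒ Δ)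
  Repl₁-renamed σ (tAtom P) p = Repl₁ {t = tAtom P} p
  Repl₁-renamed σ (tIn a) p = Repl₁ {t = tIn (renNL σ a)} p
  Repl₁-renamed σ (tNb a) p = Repl₁ {t = tNb (renNL σ a)} p
  Repl₁-renamed σ (tInS z) p = Repl₁ {t = tInS (onW σ z)} p

  Repl₂-renamed : ∀ σ t {x y Γ Δ} → lvl K ≡ lC →
    Rule K ((rel (onW σ y ∈ℓ ⟦ onW σ x ⟧) ∷ renAF σ (At t x) ∷ renAF σ (At t y) ∷ Γ ⇒ Δ) ∷ [])
           (rel (onW σ y ∈ℓ ⟦ onW σ x ⟧) ∷ renAF σ (At t y) ∷ Γ ⇒ Δ)
  Repl₂-renamed σ (tAtom P) p = Repl₂ {t = tAtom P} p
  Repl₂-renamed σ (tIn a) p = Repl₂ {t = tIn (renNL σ a)} p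
  Repl₂-renamed σ (tNb a) p = Repl₂ {t = tNb (renNL σ a)} p
  Repl₂-renamed σ (tInS z) p = Repl₂ {t = tInS (onW σ z)} p

decompose : ∀ {K Ps S} → Rule K Ps S → Decomp K Ps S
decompose (L∧ {x} {A} {B} {Γ} {Δ}) =
  decomp (only left (x ∶ (A ∧' B))) (Γ ⇒ Δ) _ (consuming₀ ∧L) (uniformly λ _ _ → L∧)
decompose (R∧ {x} {A} {B} {Γ} {Δ}) =
  decomp (only right (x ∶ (A ∧' B))) (Γ ⇒ Δ) _ (consuming₀ ∧R) (uniformly λ _ _ → R∧)
decompose (L∨ {x} {A} {B} {Γ} {Δ}) =
  decomp (only left (x ∶ (A ∨' B))) (Γ ⇒ Δ) _ (consuming₀ ∨L) (uniformly λ _ _ → L∨)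
decompose (R∨ {x} {A} {B} {Γ} {Δ}) =
  decomp (only right (x ∶ (A ∨' B))) (Γ ⇒ Δ) _ (consuming₀ ∨R) (uniformly λ _ _ → R∨)
decompose (L⇒ {x} {A} {B} {Γ} {Δ}) =
  decomp (only left (x ∶ (A ⇒' B))) (Γ ⇒ Δ) _ (consuming₀ ⇒L) (uniformly λ _ _ → L⇒)
decompose (R⇒ {x} {A} {B} {Γ} {Δ}) =
  decomp (only right (x ∶ (A ⇒' B))) (Γ ⇒ Δ) _ (consuming₀ ⇒R) (uniformly λ _ _ → R⇒)
decompose (L∀ {x} {a} {A} {Γ} {Δ}) =
  decomp (rel (x ∈ℓ a) ∷ lf (a ⊩∀ A) ∷ [] ⇒ []) (Γ ⇒ Δ) _
    (repeating (tt ∷ tt ∷ [] , []) (adding (lf (x ∶ A) ∷ [] ⇒ []) ∷ [])) (uniformly λ _ _ → L∀)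
decompose (R∀ {x} {a} {A} {Γ} {Δ} x∉) =
  decomp (only right (a ⊩∀ A)) (Γ ⇒ Δ) _ (consumingW ∀R x x∉) (eigenW x∉ λ _ _ → R∀)
decompose (L∃ {x} {a} {A} {Γ} {Δ} x∉) =
  decomp (only left (a ⊩∃ A)) (Γ ⇒ Δ) _ (consumingW ∃L x x∉) (eigenW x∉ λ _ _ → L∃)
decompose (R∃ {x} {a} {A} {Γ} {Δ}) =
  decomp (rel (x ∈ℓ a) ∷ [] ⇒ (a ⊩∃ A) ∷ []) (Γ ⇒ Δ) _
    (repeating (tt ∷ [] , tt ∷ []) (adding ([] ⇒ (x ∶ A) ∷ []) ∷ [])) (uniformly λ _ _ → R∃)
decompose (R> {x} {a} {A} {B} {Γ} {Δ} a∉) =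
  decomp (only right (x ∶ (A >' B))) (Γ ⇒ Δ) _ (consumingN >R a a∉) (eigenN a∉ λ _ _ → R>)
decompose (L> {x} {a} {A} {B} {Γ} {Δ}) =
  decomp (rel (a ∈N x) ∷ lf (x ∶ (A >' B)) ∷ [] ⇒ []) (Γ ⇒ Δ) _
    (repeating (tt ∷ tt ∷ [] , [])
      (adding ([] ⇒ (a ⊩∃ A) ∷ []) ∷ adding (lf (x ⊩[ a ] A ∣ B) ∷ [] ⇒ []) ∷ []))
    (uniformly λ _ _ → L>)
decompose (R∣ {x} {a} {c} {A} {B} {Γ} {Δ}) =
  decomp (rel (c ∈N x) ∷ rel (c ⊆ℓ a) ∷ [] ⇒ (x ⊩[ a ] A ∣ B) ∷ []) (Γ ⇒ Δ) _
    (repeating (tt ∷ tt ∷ [] , tt ∷ [])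
      ((([] ⇒ (c ⊩∃ A) ∷ []) , ↭-refl , ↭-swap _ _ ↭-refl)
       ∷ (([] ⇒ (c ⊩∀ (A ⇒' B)) ∷ []) , ↭-refl , ↭-swap _ _ ↭-refl) ∷ []))
    (uniformly λ _ _ → R∣)
decompose (L∣ {x} {a} {c} {A} {B} {Γ} {Δ} c∉) =
  decomp (only left (x ⊩[ a ] A ∣ B)) (Γ ⇒ Δ) _ (consumingN ∣L c c∉) (eigenN c∉ λ _ _ → L∣)
decompose (Ref {a} {Γ} {Δ}) =
  decomp ([] ⇒ []) (Γ ⇒ Δ) _ (repeating ([] , []) (adding (rel (a ⊆ℓ a) ∷ [] ⇒ []) ∷ []))
    (uniformly λ _ _ → Ref)
decompose (Tr {a} {b} {c} {Γ} {Δ}) =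
  decomp (rel (c ⊆ℓ b) ∷ rel (b ⊆ℓ a) ∷ [] ⇒ []) (Γ ⇒ Δ) _
    (repeating (tt ∷ tt ∷ [] , []) (adding (rel (c ⊆ℓ a) ∷ [] ⇒ []) ∷ [])) (uniformly λ _ _ → Tr)
decompose (L⊆ {x} {a} {b} {Γ} {Δ}) =
  decomp (rel (x ∈ℓ a) ∷ rel (a ⊆ℓ b) ∷ [] ⇒ []) (Γ ⇒ Δ) _
    (repeating (tt ∷ tt ∷ [] , [])
      (((rel (x ∈ℓ b) ∷ [] ⇒ []) , Perm.shift _ (_ ∷ _ ∷ []) [] , ↭-refl) ∷ []))
    (uniformly λ _ _ → L⊆)
decompose (RN {x} {a} {Γ} {Δ} p a∉) =
  decomp ([] ⇒ []) (Γ ⇒ Δ) _ (repeating ([] , []) (adding (rel (nv a ∈N x) ∷ [] ⇒ []) ∷ []))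
    (eigenN a∉ λ _ _ → RN p)
decompose (R0 {x} {y} {a} {Γ} {Δ} p y∉) =
  decomp (rel (a ∈N x) ∷ [] ⇒ []) (Γ ⇒ Δ) _
    (repeating (tt ∷ [] , []) (adding (rel (y ∈ℓ a) ∷ [] ⇒ []) ∷ []))
    (eigenW y∉ λ _ _ → R0 p)
decompose (RT {x} {a} {Γ} {Δ} p a∉) =
  decomp ([] ⇒ []) (Γ ⇒ Δ) _
    (repeating ([] , []) (adding (rel (x ∈ℓ nv a) ∷ rel (nv a ∈N x) ∷ [] ⇒ []) ∷ []))
    (eigenN a∉ λ _ _ → RT p)
decompose (RW {x} {a} {Γ} {Δ} p) =
  decomp (rel (a ∈N x) ∷ [] ⇒ []) (Γ ⇒ Δ) _
    (repeating (tt ∷ [] , []) (adding (rel (x ∈ℓ a) ∷ [] ⇒ []) ∷ []))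
    (uniformly λ _ _ → RW p)
decompose (RSingle {x} {Γ} {Δ} p) =
  decomp (rel (⟦ x ⟧ ∈N x) ∷ [] ⇒ []) (Γ ⇒ Δ) _
    (repeating (tt ∷ [] , []) (adding (rel (x ∈ℓ ⟦ x ⟧) ∷ [] ⇒ []) ∷ [])) (uniformly λ _ _ → RSingle p)
decompose (RC {x} {a} {Γ} {Δ} p) =
  decomp (rel (a ∈N x) ∷ [] ⇒ []) (Γ ⇒ Δ) _
    (repeating (tt ∷ [] , []) (adding (rel (⟦ x ⟧ ∈N x) ∷ rel (⟦ x ⟧ ⊆ℓ a) ∷ [] ⇒ []) ∷ []))
    (uniformly λ _ _ → RC p)
decompose (Repl₁ {x} {y} {t} {Γ} {Δ} p) =
  decomp (rel (y ∈ℓ ⟦ x ⟧) ∷ At t x ∷ [] ⇒ []) (Γ ⇒ Δ) _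
    (repeating (tt ∷ At-inert t x ∷ [] , []) (((At t y ∷ [] ⇒ []) , Perm.shift _ (_ ∷ _ ∷ []) [] , ↭-refl) ∷ []))
    (uniformly λ σ _ → Repl₁-renamed σ t p)
decompose (Repl₂ {x} {y} {t} {Γ} {Δ} p) =
  decomp (rel (y ∈ℓ ⟦ x ⟧) ∷ At t y ∷ [] ⇒ []) (Γ ⇒ Δ) _
    (repeating (tt ∷ At-inert t y ∷ [] , []) (((At t x ∷ [] ⇒ []) , ↭-swap _ _ ↭-refl , ↭-refl) ∷ []))
    (uniformly λ σ _ → Repl₂-renamed σ t p)
decompose (U₁ {x} {y} {z} {a} {b} {c} {Q} {Γ} {Δ} p ct c∉) =
  decomp (Q ⇒ []) (Γ ⇒ Δ) _
    (repeating (Sublist.All-resp-⊆ (proj₁ ct) (tt ∷ tt ∷ tt ∷ tt ∷ []) , [])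
      (adding (rel (z ∈ℓ nv c) ∷ rel (nv c ∈N x) ∷ [] ⇒ []) ∷ []))
    (eigenN c∉ λ σ _ → U₁ p (Contr-rename σ ct))
decompose (U₂ {x} {y} {z} {a} {b} {c} {Q} {Γ} {Δ} p ct c∉) =
  decomp (Q ⇒ []) (Γ ⇒ Δ) _
    (repeating (Sublist.All-resp-⊆ (proj₁ ct) (tt ∷ tt ∷ tt ∷ tt ∷ []) , [])
      (adding (rel (z ∈ℓ nv c) ∷ rel (nv c ∈N y) ∷ [] ⇒ []) ∷ []))
    (eigenN c∉ λ σ _ → U₂ p (Contr-rename σ ct))
decompose (A₁ {x} {y} {a} {b} {Q} {Γ} {Δ} p ct) =
  decomp (Q ⇒ []) (Γ ⇒ Δ) _
    (repeating (Sublist.All-resp-⊆ (proj₁ ct) (tt ∷ tt ∷ tt ∷ []) , []) (adding (rel (b ∈N y) ∷ [] ⇒ []) ∷ []))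
    (uniformly λ σ _ → A₁ p (Contr-rename σ ct))
decompose (A₂ {x} {y} {a} {b} {Q} {Γ} {Δ} p ct) =
  decomp (Q ⇒ []) (Γ ⇒ Δ) _
    (repeating (Sublist.All-resp-⊆ (proj₁ ct) (tt ∷ tt ∷ tt ∷ []) , []) (adding (rel (b ∈N x) ∷ [] ⇒ []) ∷ []))
    (uniformly λ σ _ → A₂ p (Contr-rename σ ct))

-- Height-preserving renaming and weakening

rename-weaken-step : ∀ {K m Ps S} → Decomp K Ps S → All (Der K m) Ps →
  (∀ {T} → Der K m T → ∀ σ W → Der K m (W ⊗ rename σ T)) →
  ∀ σ W → Der K (suc m) (W ⊗ rename σ S)
rename-weaken-step {K} {m} (decomp Π C exs _ schematic) ds ih σ W with schematic σ (W ⊗ rename σ C)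
... | σ′ , agr , r = Der-resp-≈S conclusion (ruleDer r (All-mapped exs ds premiss))
  where
  open SetoidReasoning ≈S-setoid
  conclusion : rename σ Π ⊗ (W ⊗ rename σ C) ≈S W ⊗ rename σ (Π ⊗ C)
  conclusion = begin
    rename σ Π ⊗ (W ⊗ rename σ C) ≈⟨ ⊗-swap (rename σ Π) W (rename σ C) ⟩
    W ⊗ (rename σ Π ⊗ rename σ C) ≡⟨ cong (W ⊗_) (rename-⊗ σ Π C) ⟨
    W ⊗ rename σ (Π ⊗ C)          ∎
  premiss : ∀ {E} → Der K m (E ⊗ C) → Der K m (rename σ′ E ⊗ (W ⊗ rename σ C))
  premiss {E} d = Der-resp-≈S renamed (ih d σ′ W)
    where
    renamed : W ⊗ rename σ′ (E ⊗ C) ≈S rename σ′ E ⊗ (W ⊗ rename σ C)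
    renamed = begin
      W ⊗ rename σ′ (E ⊗ C)           ≡⟨ cong (W ⊗_) (rename-⊗ σ′ E C) ⟩
      W ⊗ (rename σ′ E ⊗ rename σ′ C) ≡⟨ cong (λ T → W ⊗ (rename σ′ E ⊗ T)) (agree-rename C agr) ⟩
      W ⊗ (rename σ′ E ⊗ rename σ C)  ≈⟨ ⊗-swap W (rename σ′ E) (rename σ C) ⟩
      rename σ′ E ⊗ (W ⊗ rename σ C)  ∎

rename-weaken : ∀ {K n S} → Der K n S → ∀ σ W → Der K n (W ⊗ rename σ S)
rename-weaken (init i) σ W = init (Initial-⊑ (⊑-⊗ʳ W _) (Initial-rename σ i))
rename-weaken {n = suc m} (step (_ , _ , r , S≈ , pw) ds) σ W =
  Der-resp-≈S (⊗-congʳ W (rename-resp σ (≈S-sym S≈)))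
    (rename-weaken-step (decompose r) (All-resp-Pointwise Der-resp-≈S pw ds) (rename-weaken {n = m}) σ W)

rename-Der : ∀ {K n S} → Der K n S → ∀ σ → Der K n (rename σ S)
rename-Der d σ = rename-weaken d σ ([] ⇒ [])

weaken : ∀ {K n S} → Der K n S → ∀ W → Der K n (W ⊗ S)
weaken {S = S} d W = subst (λ T → Der _ _ (W ⊗ T)) (rename-id S) (rename-weaken d idR W)

-- Inversion of consuming rules

rename-canon : ∀ {K n s F C} (iv : Consumed s F) {w d} →
  w ∉ wSeq (only s F ⊗ C) → nv d ∉ nSeq (only s F ⊗ C) →
  (∀ {E} → E ∈ canon iv w d → Der K n (E ⊗ C)) →
  ∀ x c {E} → E ∈ canon iv x c → Der K n (E ⊗ C)
rename-canon {K} {n} {s} {F} {C} iv {w} {d} w∉ d∉ ders x c E∈ =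
  renamed (∈-map⁻ (rename σ) (subst (_ ∈_) (sym canon-renamed) E∈))
  where
  σ = updateN (updateW idR w x) d c
  agr : Agree σ idR (only s F ⊗ C)
  agr = agree-trans (only s F ⊗ C) (updateN-agree _ d∉) (updateW-agree _ w∉)
  F-fixed : renLF σ F ≡ F
  F-fixed = only-injective s (begin
    only s (renLF σ F)    ≡⟨ rename-only σ s F ⟨
    rename σ (only s F)   ≡⟨ agree-rename (only s F) (agree-⊑ (⊑-⊗ˡ _ C) agr) ⟩
    rename idR (only s F) ≡⟨ rename-id (only s F) ⟩
    only s F              ∎)
    where open ≡-Reasoning
  canon-renamed : map (rename σ) (canon iv w d) ≡ canon iv x c
  canon-renamed = begin
    map (rename σ) (canon iv w d)                     ≡⟨ canon-rename σ iv w d ⟩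
    canon (Consumed-rename σ iv) (onW σ w) (onN σ d) ≡⟨ cong₂ (canon (Consumed-rename σ iv))
                                                         (update-at _ w x) (update-at _ d c) ⟩
    canon (Consumed-rename σ iv) x c                  ≡⟨ canon-cong F-fixed _ iv x c ⟩
    canon iv x c                                      ∎
    where open ≡-Reasoning
  C-fixed : rename σ C ≡ C
  C-fixed = trans (agree-rename C (agree-⊑ (⊑-⊗ʳ _ C) agr)) (rename-id C)
  renamed : ∀ {E} → (∃ λ E₀ → E₀ ∈ canon iv w d × E ≡ rename σ E₀) → Der K n (E ⊗ C)
  renamed (E₀ , E₀∈ , refl) =
    subst (Der K n) (trans (rename-⊗ σ E₀ C) (cong (rename σ E₀ ⊗_) C-fixed)) (rename-Der (ders E₀∈) σ)

-- The labels x and c need not be fresh.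
Inversion : Calc → ℕ → Set
Inversion K n = ∀ {S s F} → Der K n S → (iv : Consumed s F) (C : Seq) (x c : ℕ) →
  S ≈S only s F ⊗ C → ∀ {E} → E ∈ canon iv x c → Der K n (E ⊗ C)

invert-principal : ∀ {K m Π C′ exs s F C} → RuleKind (Π ⊗ C′) Π exs → Occurs s F Π →
  (iv : Consumed s F) → Π ⊗ C′ ≈S only s F ⊗ C → All (Der K m) (map (_⊗ C′) exs) →
  ∀ x c {E} → E ∈ canon iv x c → Der K m (E ⊗ C)
invert-principal (repeating inert _) F∈Π iv _ _ _ _ _ = ⊥-elim (consumed-not-inert iv (inert-occurs inert F∈Π))
invert-principal {s = s} (consuming iv′ w d w∉ d∉) F∈Π iv eq ds x c E∈ with occurs-only⁻ F∈Π
... | refl with consumed-unique iv iv′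
... | refl = Der-resp-≈S (⊗-congʳ _ (only-cancel s eq))
               (rename-canon iv w∉ d∉ (All.lookup (AllP.map⁻ ds)) x c E∈)

invert-context : ∀ {K m Π C′ exs s F C C₀} → Schematic K Π C′ exs → C′ ≈S only s F ⊗ C₀ →
  Π ⊗ C′ ≈S only s F ⊗ C → All (Der K m) (map (_⊗ C′) exs) → Inversion K m →
  (iv : Consumed s F) → ∀ x c {E} → E ∈ canon iv x c → Der K (suc m) (E ⊗ C)
invert-context {K} {m} {Π} {C′} {exs} {s} {F} {C} {C₀} schematic C′≈ eq ds ih iv x c {E} E∈
  with schematic idR (E ⊗ C₀)
... | σ′ , agr , r = Der-resp-≈S conclusion (ruleDer r (All-mapped exs ds premiss))
  where
  open SetoidReasoning ≈S-setoid
  rest : Π ⊗ C₀ ≈S C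
  rest = only-cancel s (begin
    only s F ⊗ (Π ⊗ C₀) ≈⟨ ⊗-swap Π (only s F) C₀ ⟨
    Π ⊗ (only s F ⊗ C₀) ≈⟨ ⊗-congʳ Π C′≈ ⟨
    Π ⊗ C′              ≈⟨ eq ⟩
    only s F ⊗ C        ∎)
  conclusion : rename idR Π ⊗ (E ⊗ C₀) ≈S E ⊗ C
  conclusion = begin
    rename idR Π ⊗ (E ⊗ C₀) ≡⟨ cong (_⊗ (E ⊗ C₀)) (rename-id Π) ⟩
    Π ⊗ (E ⊗ C₀)            ≈⟨ ⊗-swap Π E C₀ ⟩
    E ⊗ (Π ⊗ C₀)            ≈⟨ ⊗-congʳ E rest ⟩
    E ⊗ C                   ∎
  premiss : ∀ {e} → Der K m (e ⊗ C′) → Der K m (rename σ′ e ⊗ (E ⊗ C₀))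
  premiss {e} d =
    Der-resp-≈S (⊗-swap E (rename σ′ e) C₀) (ih (rename-Der d σ′) iv (rename σ′ e ⊗ C₀) x c renamed E∈)
    where
    renamed : rename σ′ (e ⊗ C′) ≈S only s F ⊗ (rename σ′ e ⊗ C₀)
    renamed = begin
      rename σ′ (e ⊗ C′)             ≡⟨ rename-⊗ σ′ e C′ ⟩
      rename σ′ e ⊗ rename σ′ C′     ≡⟨ cong (rename σ′ e ⊗_) (agree-rename C′ agr) ⟩
      rename σ′ e ⊗ rename idR C′    ≡⟨ cong (rename σ′ e ⊗_) (rename-id C′) ⟩
      rename σ′ e ⊗ C′               ≈⟨ ⊗-congʳ (rename σ′ e) C′≈ ⟩
      rename σ′ e ⊗ (only s F ⊗ C₀)  ≈⟨ ⊗-swap (rename σ′ e) (only s F) C₀ ⟩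
      only s F ⊗ (rename σ′ e ⊗ C₀)  ∎

invert-step : ∀ {K m Ps S} → Decomp K Ps S → All (Der K m) Ps → Inversion K m →
  ∀ {s F} (iv : Consumed s F) C x c → S ≈S only s F ⊗ C → ∀ {E} → E ∈ canon iv x c → Der K (suc m) (E ⊗ C)
invert-step (decomp Π C′ exs kind schematic) ds ih {s} iv C x c eq E∈
  with occurs-⊗ Π (occurs-resp (≈S-sym eq) (occurs-only s))
... | inj₁ F∈Π = Der-mono (invert-principal kind F∈Π iv eq ds x c E∈)
... | inj₂ F∈C′ with occurs-split F∈C′
...   | _ , C′≈ = invert-context schematic C′≈ eq ds ih iv x c E∈

invert : ∀ {K} n → Inversion K n
invert n (init i) iv C x c eq _ = init (Initial-⊑ (⊑-⊗ʳ _ C) (Initial-drop iv (Initial-⊑ (≈S⇒⊑ eq) i)))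
invert (suc m) (step (_ , _ , r , S≈ , pw) ds) iv C x c eq =
  invert-step (decompose r) (All-resp-Pointwise Der-resp-≈S pw ds) (invert m) iv C x c (≈S-trans (≈S-sym S≈) eq)

rule-invertible : ∀ {K n Ps S} → Decomp K Ps S → Der K n S → All (Der K n) Ps
rule-invertible (decomp Π C _ (consuming iv w c _ _) _) d = AllP.map⁺ (All.tabulate (invert _ d iv C w c ≈S-refl))
rule-invertible {K} {n} (decomp Π C _ (repeating _ repeats) _) d = AllP.map⁺ (All.map weakened repeats)
  where
  weakened : ∀ {E} → (∃ λ E′ → E ≈S E′ ⊗ Π) → Der K n (E ⊗ C)
  weakened (E′ , E≈) = Der-resp-≈S (subst (_≈S _) (⊗-assoc E′ Π C) (⊗-congˡ C (≈S-sym E≈))) (weaken d E′)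

mainTheorem11 : (K : Calc) (n : ℕ) {Ps : List Seq} {S : Seq} →
    Inst K Ps S → Der K n S → All (Der K n) Ps
mainTheorem11 K n (_ , _ , r , S≈ , pw) d =
  All-resp-Pointwise Der-resp-≈S (symmetric ≈S-sym pw) (rule-invertible (decompose r) (Der-resp-≈S S≈ d))
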